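{- Let $D=(G,\mathcal{O},w)$ be a weighted oriented graph and $C=(z_1,z_2,z_3,z_4,z_5,z_1)$ a basic $5$-cycle of $G$ with $(z_1,z_2),(z_2,z_3)\in E(D)$ and $z_2\in V^{+}$. Suppose $C$ satisfies one of: (a) $(z_3,z_4)\in E(D)$ and $z_3\in V^{+}$; (b) $(z_1,z_5),(z_5,z_4)\in E(D)$ and $z_5\in V^{+}$. Then there is a strong vertex cover $\tilde{\mathcal{C}}$ of $D$ with $|\tilde{\mathcal{C}}\cap V(C)|=4$.
   Context: A weighted oriented graph is a triple $D=(G,\mathcal{O},w)$ with $G$ a finite simple graph, $\mathcal{O}$ an orientation of its edges, $w:V(G)\to\mathbb{N}$; $E(D)$ is the set of oriented edges. $V^{+}=\{x\mid w(x)>1\}$. $N_D^{+}(x)=\{y\mid(x,y)\in E(D)\}$, $N_D^{ - }(x)=\{y\mid(y,x)\in E(D)\}$. Standing convention: every source (vertex with $N_D^-(x)=\emptyset$) has weight $1$. A vertex cover of $D$ is a set of vertices meeting every edge. For a vertex cover $\mathcal{C}$: $L_1(\mathcal{C})=\{x\in\mathcal{C}\mid N_D^+(x)\setminus\mathcal{C}\ne\emptyset\}$, $L_2(\mathcal{C})=\{x\in\mathcal{C}\setminus L_1(\mathcal{C})\mid N_D^-(x)\setminus\mathcal{C}\ne\emptyset\}$, $L_3(\mathcal{C})=\mathcal{C}\setminus(L_1(\mathcal{C})\cup L_2(\mathcal{C}))$. $\mathcal{C}$ is strong if for every $x\in L_3(\mathcal{C})$ there is $(y,x)\in E(D)$ with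 $y\in(\mathcal{C}\setminus L_1(\mathcal{C}))\cap V^+$. A basic $5$-cycle is an induced $5$-cycle of $G$ containing no two adjacent vertices both of degree $\ge3$ in $G$. -}

module Defs where

open import Data.Nat using (ℕ; _≤_; _<_)
open import Data.Bool using (Bool; true; false; _∨_)
open import Data.Fin using (Fin)
open import Data.Fin.Subset using (Subset; _∈_; _∉_; _∩_; _∪_; ⁅_⁆; ∣_∣)
open import Data.List using (length; filterᵇ; allFin)
open import Data.Product using (Σ; ∃; ∃-syntax; _×_)
open import Data.Sum using (_⊎_)
open import Relation.Nullary using (¬_)
open import Relation.Binary.PropositionalEquality using (_≡_; _≢_)

-- The underlying finite simple graph G has x ~ y iff (x,y) or (y,x) is an arc;
-- the orientation gives each edge exactly one direction (asymmetry), no loops.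
record WOG (n : ℕ) : Set where
  field
    arc     : Fin n → Fin n → Bool
    irrefl  : ∀ x → arc x x ≡ false
    asym    : ∀ x y → arc x y ≡ true → arc y x ≡ false
    w       : Fin n → ℕ
    w-pos   : ∀ x → 1 ≤ w x
    -- standing convention: every source has weight 1
    source-w : ∀ x → (∀ y → arc y x ≡ false) → w x ≡ 1
open WOG public

module _ {n : ℕ} (D : WOG n) where

  E : Fin n → Fin n → Set
  E x y = arc D x y ≡ true

  Adj : Fin n → Fin n → Set
  Adj x y = E x y ⊎ E y x

  adjᵇ : Fin n → Fin n → Bool
  adjᵇ x y = arc D x y ∨ arc D y x

  deg : Fin n → ℕ
  deg x = length (filterᵇ (adjᵇ x) (allFin n))

  V⁺ : Fin n → Set
  V⁺ x = 1 < w D x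

  IsVertexCover : Subset n → Set
  IsVertexCover C = ∀ x y → E x y → x ∈ C ⊎ y ∈ C

  L₁ : Subset n → Fin n → Set
  L₁ C x = x ∈ C × ∃[ y ] (E x y × y ∉ C)

  L₂ : Subset n → Fin n → Set
  L₂ C x = x ∈ C × ¬ L₁ C x × ∃[ y ] (E y x × y ∉ C)

  L₃ : Subset n → Fin n → Set
  L₃ C x = x ∈ C × ¬ L₁ C x × ¬ L₂ C x

  IsStrongVertexCover : Subset n → Set
  IsStrongVertexCover C =
    IsVertexCover C ×
    (∀ x → L₃ C x → ∃[ y ] (E y x × (y ∈ C × ¬ L₁ C y) × V⁺ y))

  record Basic5Cycle (z₁ z₂ z₃ z₄ z₅ : Fin n) : Set where
    field
      d12 : z₁ ≢ z₂
      d13 : z₁ ≢ z₃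
      d14 : z₁ ≢ z₄
      d15 : z₁ ≢ z₅
      d23 : z₂ ≢ z₃
      d24 : z₂ ≢ z₄
      d25 : z₂ ≢ z₅
      d34 : z₃ ≢ z₄
      d35 : z₃ ≢ z₅
      d45 : z₄ ≢ z₅
      e12 : Adj z₁ z₂
      e23 : Adj z₂ z₃
      e34 : Adj z₃ z₄
      e45 : Adj z₄ z₅
      e51 : Adj z₅ z₁
      n13 : ¬ Adj z₁ z₃
      n14 : ¬ Adj z₁ z₄
      n24 : ¬ Adj z₂ z₄
      n25 : ¬ Adj z₂ z₅
      n35 : ¬ Adj z₃ z₅
      b12 : ¬ (3 ≤ deg z₁ × 3 ≤ deg z₂)
      b23 : ¬ (3 ≤ deg z₂ × 3 ≤ deg z₃)
      b34 : ¬ (3 ≤ deg z₃ × 3 ≤ deg z₄)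
      b45 : ¬ (3 ≤ deg z₄ × 3 ≤ deg z₅)
      b51 : ¬ (3 ≤ deg z₅ × 3 ≤ deg z₁)

  cycleSet : (z₁ z₂ z₃ z₄ z₅ : Fin n) → Subset n
  cycleSet z₁ z₂ z₃ z₄ z₅ = ⁅ z₁ ⁆ ∪ (⁅ z₂ ⁆ ∪ (⁅ z₃ ⁆ ∪ (⁅ z₄ ⁆ ∪ ⁅ z₅ ⁆)))

{-# OPTIONS --safe #-}
module Submission where

-- Let q be z₃ in case (a) and z₅ in case (b). The guards z₂ and q lie in V⁺, have no arc
-- to z₁, and every other vertex of the cycle is adjacent to z₁ or an out-neighbour of a
-- guard. Extend {z₁} to an independent set S that is maximal among the vertices off the
-- cycle without a guard in-neighbour, and take the complement of S: it is a vertex cover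
-- meeting the cycle in everything but z₁. A vertex of the cover with a neighbour in S lies
-- in L₁ ∪ L₂, so by maximality every vertex of L₃ has a guard in-neighbour, and a guard,
-- all of whose out-neighbours are in the cover, is outside L₁.

open import Defs
open import Data.Nat using (ℕ; suc)
open import Data.Bool using (true; _≟_)
open import Data.Bool.Properties using (not-¬)
open import Data.Fin using (Fin; zero; suc)
open import Data.Fin.Properties using (any?)
open import Data.Fin.Subset
  using (Subset; inside; outside; _∈_; _∉_; _⊆_; _∩_; _∪_; ∁; ⁅_⁆; ∣_∣)
open import Data.Fin.Subset.Properties
  using (_∈?_; x∈⁅x⁆; x∈⁅y⁆⇒x≡y; x∈p∪q⁺; x∈p∪q⁻; x∈p∩q⁺; x∈p∩q⁻; q⊆p∪q;
         x∈p⇒x∉∁p; x∉p⇒x∈∁p; x∈∁p⇒x∉p; x≢y⇒x∉⁅y⁆; ⊆-antisym; ∪-identityˡ; ∣⁅x⁆∣≡1)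
open import Data.List using (List; []; _∷_; allFin)
open import Data.List.Membership.Propositional using () renaming (_∈_ to _∈ˡ_)
open import Data.List.Membership.Propositional.Properties using (∈-allFin)
open import Data.List.Relation.Unary.Any using (here; there)
open import Data.Vec using (_∷_)
open import Data.Vec.Base using () renaming (here to hereᵛ; there to thereᵛ)
open import Data.Product using (∃-syntax; _×_; _,_; proj₁; proj₂)
open import Data.Sum using (_⊎_; inj₁; inj₂; swap)
open import Data.Empty using (⊥-elim)
open import Function using (_∘_)
open import Relation.Nullary using (¬_; Dec; yes; no)
open import Relation.Nullary.Decidable using (_×-dec_; _⊎-dec_; ¬?)
open import Level using (0ℓ)
open import Relation.Unary using (Pred; Decidable)
open import Relation.Binary.PropositionalEquality using (_≡_; _≢_; refl; cong; trans)

x∉p⇒∣⁅x⁆∪p∣≡suc∣p∣ : ∀ {n} {x : Fin n} {p : Subset n} → x ∉ p → ∣ ⁅ x ⁆ ∪ p ∣ ≡ suc ∣ p ∣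
x∉p⇒∣⁅x⁆∪p∣≡suc∣p∣ {x = zero}  {outside ∷ p} _   = cong (suc ∘ ∣_∣) (∪-identityˡ p)
x∉p⇒∣⁅x⁆∪p∣≡suc∣p∣ {x = zero}  {inside ∷ p}  x∉p = ⊥-elim (x∉p hereᵛ)
x∉p⇒∣⁅x⁆∪p∣≡suc∣p∣ {x = suc x} {outside ∷ p} x∉p = x∉p⇒∣⁅x⁆∪p∣≡suc∣p∣ (x∉p ∘ thereᵛ)
x∉p⇒∣⁅x⁆∪p∣≡suc∣p∣ {x = suc x} {inside ∷ p}  x∉p = cong suc (x∉p⇒∣⁅x⁆∪p∣≡suc∣p∣ (x∉p ∘ thereᵛ))

module _ {n : ℕ} where

  x∈⁅y⁆∪p⁻ : ∀ {x y : Fin n} {p} → x ∈ ⁅ y ⁆ ∪ p → x ≡ y ⊎ x ∈ p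
  x∈⁅y⁆∪p⁻ {y = y} {p} x∈ with x∈p∪q⁻ ⁅ y ⁆ p x∈
  ... | inj₁ x∈⁅y⁆ = inj₁ (x∈⁅y⁆⇒x≡y y x∈⁅y⁆)
  ... | inj₂ x∈p   = inj₂ x∈p

  x∉⁅y⁆∪p : ∀ {x y : Fin n} {p} → x ≢ y → x ∉ p → x ∉ ⁅ y ⁆ ∪ p
  x∉⁅y⁆∪p x≢y x∉p x∈ with x∈⁅y⁆∪p⁻ x∈
  ... | inj₁ x≡y = x≢y x≡y
  ... | inj₂ x∈p = x∉p x∈p

  x∉q⇒p⊆q⇒q∩[⁅x⁆∪p]≡p : ∀ {x : Fin n} {p q} → x ∉ q → p ⊆ q → q ∩ (⁅ x ⁆ ∪ p) ≡ p
  x∉q⇒p⊆q⇒q∩[⁅x⁆∪p]≡p {x} {p} {q} x∉q p⊆q =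
    ⊆-antisym ⊆p (λ y∈p → x∈p∩q⁺ (p⊆q y∈p , q⊆p∪q ⁅ x ⁆ p y∈p))
    where
    ⊆p : q ∩ (⁅ x ⁆ ∪ p) ⊆ p
    ⊆p y∈ with x∈p∩q⁻ q _ y∈
    ... | y∈q , y∈⁅x⁆∪p with x∈⁅y⁆∪p⁻ y∈⁅x⁆∪p
    ...   | inj₁ refl = ⊥-elim (x∉q y∈q)
    ...   | inj₂ y∈p  = y∈p

module _ {n : ℕ} (D : WOG n) where

  E? : ∀ x y → Dec (E D x y)
  E? x y = arc D x y ≟ true

  E-irrefl : ∀ x → ¬ E D x x
  E-irrefl x xx = not-¬ xx (irrefl D x)

  E-asym : ∀ {x y} → E D x y → ¬ E D y x
  E-asym {x} {y} xy yx = not-¬ yx (asym D x y xy)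

  Adj? : ∀ x y → Dec (Adj D x y)
  Adj? x y = E? x y ⊎-dec E? y x

  Independent : Subset n → Set
  Independent S = ∀ {a b} → a ∈ S → b ∈ S → ¬ E D a b

  HasNeighbourIn : Subset n → Fin n → Set
  HasNeighbourIn S x = ∃[ a ] (a ∈ S × Adj D x a)

  hasNeighbourIn? : ∀ S x → Dec (HasNeighbourIn S x)
  hasNeighbourIn? S x = any? λ a → (a ∈? S) ×-dec Adj? x a

  Dominated : Subset n → Fin n → Set
  Dominated S x = x ∈ S ⊎ HasNeighbourIn S x

  Dominated-mono : ∀ {S S′ x} → S ⊆ S′ → Dominated S x → Dominated S′ x
  Dominated-mono S⊆S′ (inj₁ x∈S) = inj₁ (S⊆S′ x∈S)
  Dominated-mono S⊆S′ (inj₂ (a , a∈S , x~a)) = inj₂ (a , S⊆S′ a∈S , x~a)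

  module GreedyExtension {P : Pred (Fin n) 0ℓ} (P? : Decidable P) where

    step : Subset n → Fin n → Subset n
    step S x with P? x | hasNeighbourIn? S x
    ... | yes _ | no _ = ⁅ x ⁆ ∪ S
    ... | _     | _    = S

    step-⊇ : ∀ S x → S ⊆ step S x
    step-⊇ S x with P? x | hasNeighbourIn? S x
    ... | yes _ | no _  = q⊆p∪q ⁅ x ⁆ S
    ... | yes _ | yes _ = λ y∈S → y∈S
    ... | no _  | _     = λ y∈S → y∈S

    step-⊆ : ∀ S x {y} → y ∈ step S x → y ∈ S ⊎ P y
    step-⊆ S x y∈ with P? x | hasNeighbourIn? S x
    ... | yes Px | no _ with x∈⁅y⁆∪p⁻ y∈
    ...   | inj₁ refl = inj₂ Px
    ...   | inj₂ y∈S  = inj₁ y∈S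
    step-⊆ S x y∈ | yes _ | yes _ = inj₁ y∈
    step-⊆ S x y∈ | no _  | _     = inj₁ y∈

    step-independent : ∀ S x → Independent S → Independent (step S x)
    step-independent S x indep with P? x | hasNeighbourIn? S x
    ... | yes _ | no free = indep′
      where
      indep′ : Independent (⁅ x ⁆ ∪ S)
      indep′ a∈ b∈ with x∈⁅y⁆∪p⁻ a∈ | x∈⁅y⁆∪p⁻ b∈
      ... | inj₁ refl | inj₁ refl = E-irrefl x
      ... | inj₁ refl | inj₂ b∈S  = λ xb → free (_ , b∈S , inj₁ xb)
      ... | inj₂ a∈S  | inj₁ refl = λ ax → free (_ , a∈S , inj₂ ax)
      ... | inj₂ a∈S  | inj₂ b∈S  = indep a∈S b∈S
    ... | yes _ | yes _ = indep
    ... | no _  | _     = indep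

    step-dominates : ∀ S x → P x → Dominated (step S x) x
    step-dominates S x Px with P? x | hasNeighbourIn? S x
    ... | yes _ | no _  = inj₁ (x∈p∪q⁺ (inj₁ (x∈⁅x⁆ x)))
    ... | yes _ | yes nb = inj₂ nb
    ... | no ¬Px | _    = ⊥-elim (¬Px Px)

    greedy : Subset n → List (Fin n) → Subset n
    greedy S []       = S
    greedy S (x ∷ xs) = greedy (step S x) xs

    greedy-⊇ : ∀ S xs → S ⊆ greedy S xs
    greedy-⊇ S []       = λ y∈S → y∈S
    greedy-⊇ S (x ∷ xs) = λ y∈S → greedy-⊇ (step S x) xs (step-⊇ S x y∈S)

    greedy-⊆ : ∀ S xs {y} → y ∈ greedy S xs → y ∈ S ⊎ P y
    greedy-⊆ S []       y∈ = inj₁ y∈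
    greedy-⊆ S (x ∷ xs) y∈ with greedy-⊆ (step S x) xs y∈
    ... | inj₁ y∈step = step-⊆ S x y∈step
    ... | inj₂ Py     = inj₂ Py

    greedy-independent : ∀ S xs → Independent S → Independent (greedy S xs)
    greedy-independent S []       indep = indep
    greedy-independent S (x ∷ xs) indep =
      greedy-independent (step S x) xs (step-independent S x indep)

    greedy-dominates : ∀ S xs {x} → x ∈ˡ xs → P x → Dominated (greedy S xs) x
    greedy-dominates S (x ∷ xs) (here refl) Px =
      Dominated-mono (greedy-⊇ (step S x) xs) (step-dominates S x Px)
    greedy-dominates S (y ∷ xs) (there x∈xs) Px = greedy-dominates (step S y) xs x∈xs Px

  record MaximalIndependentExtension (P : Pred (Fin n) 0ℓ) (S₀ : Subset n) : Set where
    field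
      S           : Subset n
      ⊇S₀         : S₀ ⊆ S
      ⊆S₀∪P       : ∀ {y} → y ∈ S → y ∈ S₀ ⊎ P y
      independent : Independent S
      dominates   : ∀ x → P x → Dominated S x

  maximalIndependentExtension : ∀ {P} → Decidable P → ∀ S₀ → Independent S₀ →
                                MaximalIndependentExtension P S₀
  maximalIndependentExtension P? S₀ indep = record
    { S           = greedy S₀ (allFin n)
    ; ⊇S₀         = greedy-⊇ S₀ (allFin n)
    ; ⊆S₀∪P       = greedy-⊆ S₀ (allFin n)
    ; independent = greedy-independent S₀ (allFin n) indep
    ; dominates   = λ x → greedy-dominates S₀ (allFin n) (∈-allFin x)
    }
    where open GreedyExtension P?

  ∁-isVertexCover : ∀ {S} → Independent S → IsVertexCover D (∁ S)
  ∁-isVertexCover {S} indep x y xy with x ∈? S | y ∈? S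
  ... | yes x∈S | yes y∈S = ⊥-elim (indep x∈S y∈S xy)
  ... | no x∉S  | _       = inj₁ (x∉p⇒x∈∁p x∉S)
  ... | yes _   | no y∉S  = inj₂ (x∉p⇒x∈∁p y∉S)

  neighbourOutside⇒¬L₃ : ∀ {C x a} → Adj D x a → a ∉ C → ¬ L₃ D C x
  neighbourOutside⇒¬L₃ (inj₁ xa) a∉C (x∈C , ¬L₁ , _)   = ¬L₁ (x∈C , _ , xa , a∉C)
  neighbourOutside⇒¬L₃ (inj₂ ax) a∉C (x∈C , ¬L₁ , ¬L₂) = ¬L₂ (x∈C , ¬L₁ , _ , ax , a∉C)

  outClosed⇒¬L₁ : ∀ {C w} → (∀ y → E D w y → y ∈ C) → ¬ L₁ D C w
  outClosed⇒¬L₁ closed (_ , y , wy , y∉C) = y∉C (closed y wy)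

  module GuardedCover (z : Fin n) (T W : Subset n) (z∉T : z ∉ T)
    (guard : ∀ {w} → w ∈ W → w ∈ T × ¬ E D w z × V⁺ D w)
    (cover : ∀ {x} → x ∈ T → Adj D z x ⊎ ∃[ w ] (w ∈ W × E D w x)) where

    Guarded : Pred (Fin n) 0ℓ
    Guarded x = ∃[ w ] (w ∈ W × E D w x)

    guarded? : Decidable Guarded
    guarded? x = any? λ w → (w ∈? W) ×-dec E? w x

    Free : Pred (Fin n) 0ℓ
    Free y = y ∉ T × ¬ Guarded y

    free? : Decidable Free
    free? y = ¬? (y ∈? T) ×-dec ¬? (guarded? y)

    ⁅z⁆-independent : Independent ⁅ z ⁆
    ⁅z⁆-independent a∈ b∈ rewrite x∈⁅y⁆⇒x≡y z a∈ | x∈⁅y⁆⇒x≡y z b∈ = E-irrefl z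

    open MaximalIndependentExtension (maximalIndependentExtension free? ⁅ z ⁆ ⁅z⁆-independent)

    C : Subset n
    C = ∁ S

    z∈S : z ∈ S
    z∈S = ⊇S₀ (x∈⁅x⁆ z)

    ∈S⇒≡z⊎Free : ∀ {y} → y ∈ S → y ≡ z ⊎ Free y
    ∈S⇒≡z⊎Free y∈S with ⊆S₀∪P y∈S
    ... | inj₁ y∈⁅z⁆ = inj₁ (x∈⁅y⁆⇒x≡y z y∈⁅z⁆)
    ... | inj₂ free  = inj₂ free

    T⊆C : T ⊆ C
    T⊆C {x} x∈T = x∉p⇒x∈∁p x∉S
      where
      x∉S : x ∉ S
      x∉S x∈S with ∈S⇒≡z⊎Free x∈S
      ... | inj₁ refl      = z∉T x∈T
      ... | inj₂ (x∉T , _) = x∉T x∈T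

    guard-¬L₁ : ∀ {w} → w ∈ W → w ∈ C × ¬ L₁ D C w
    guard-¬L₁ {w} w∈W = T⊆C (proj₁ (guard w∈W)) , outClosed⇒¬L₁ λ y wy → x∉p⇒x∈∁p (y∉S y wy)
      where
      y∉S : ∀ y → E D w y → y ∉ S
      y∉S y wy y∈S with ∈S⇒≡z⊎Free y∈S
      ... | inj₁ refl            = proj₁ (proj₂ (guard w∈W)) wy
      ... | inj₂ (_ , unguarded) = unguarded (w , w∈W , wy)

    unguarded⇒¬L₃ : ∀ {x} → ¬ Guarded x → ¬ L₃ D C x
    unguarded⇒¬L₃ {x} unguarded l3 with x ∈? T
    ... | yes x∈T with cover x∈T
    ...   | inj₁ z~x     = neighbourOutside⇒¬L₃ (swap z~x) (x∈p⇒x∉∁p z∈S) l3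
    ...   | inj₂ guarded = unguarded guarded
    unguarded⇒¬L₃ {x} unguarded l3 | no x∉T with dominates x (x∉T , unguarded)
    ... | inj₁ x∈S              = x∈∁p⇒x∉p (proj₁ l3) x∈S
    ... | inj₂ (a , a∈S , x~a) = neighbourOutside⇒¬L₃ x~a (x∈p⇒x∉∁p a∈S) l3

    isStrongVertexCover : IsStrongVertexCover D C
    isStrongVertexCover = ∁-isVertexCover independent , strong
      where
      strong : ∀ x → L₃ D C x → ∃[ y ] (E D y x × (y ∈ C × ¬ L₁ D C y) × V⁺ D y)
      strong x l3 with guarded? x
      ... | yes (w , w∈W , wx) = w , wx , guard-¬L₁ w∈W , proj₂ (proj₂ (guard w∈W))
      ... | no unguarded       = ⊥-elim (unguarded⇒¬L₃ unguarded l3)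

  strongVertexCover-avoiding :
    ∀ z T W → z ∉ T →
    (∀ {w} → w ∈ W → w ∈ T × ¬ E D w z × V⁺ D w) →
    (∀ {x} → x ∈ T → Adj D z x ⊎ ∃[ w ] (w ∈ W × E D w x)) →
    ∃[ C ] (IsStrongVertexCover D C × C ∩ (⁅ z ⁆ ∪ T) ≡ T)
  strongVertexCover-avoiding z T W z∉T guard cover =
    C , isStrongVertexCover , x∉q⇒p⊆q⇒q∩[⁅x⁆∪p]≡p (x∈p⇒x∉∁p z∈S) T⊆C
    where open GuardedCover z T W z∉T guard cover

module FiveCycle {n} (D : WOG n) {z₁ z₂ z₃ z₄ z₅ : Fin n} (B : Basic5Cycle D z₁ z₂ z₃ z₄ z₅)
                 (z₁z₂ : E D z₁ z₂) (z₂z₃ : E D z₂ z₃) (z₂⁺ : V⁺ D z₂) where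
  open Basic5Cycle B

  T : Subset n
  T = ⁅ z₂ ⁆ ∪ (⁅ z₃ ⁆ ∪ (⁅ z₄ ⁆ ∪ ⁅ z₅ ⁆))

  z₂∈T : z₂ ∈ T
  z₂∈T = x∈p∪q⁺ (inj₁ (x∈⁅x⁆ z₂))

  z₃∈T : z₃ ∈ T
  z₃∈T = x∈p∪q⁺ (inj₂ (x∈p∪q⁺ (inj₁ (x∈⁅x⁆ z₃))))

  z₅∈T : z₅ ∈ T
  z₅∈T = x∈p∪q⁺ (inj₂ (x∈p∪q⁺ (inj₂ (x∈p∪q⁺ (inj₂ (x∈⁅x⁆ z₅))))))

  z₁∉T : z₁ ∉ T
  z₁∉T = x∉⁅y⁆∪p d12 (x∉⁅y⁆∪p d13 (x∉⁅y⁆∪p d14 (x≢y⇒x∉⁅y⁆ d15)))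

  ∣T∣≡4 : ∣ T ∣ ≡ 4
  ∣T∣≡4 =
    trans (x∉p⇒∣⁅x⁆∪p∣≡suc∣p∣ (x∉⁅y⁆∪p d23 (x∉⁅y⁆∪p d24 (x≢y⇒x∉⁅y⁆ d25))))
      (cong suc (trans (x∉p⇒∣⁅x⁆∪p∣≡suc∣p∣ (x∉⁅y⁆∪p d34 (x≢y⇒x∉⁅y⁆ d35)))
        (cong suc (trans (x∉p⇒∣⁅x⁆∪p∣≡suc∣p∣ (x≢y⇒x∉⁅y⁆ d45)) (cong suc (∣⁅x⁆∣≡1 z₅))))))

  strongCover-guardedBy : ∀ q → q ∈ T → ¬ E D q z₁ → V⁺ D q → E D q z₄ →
    ∃[ C ] (IsStrongVertexCover D C × ∣ C ∩ cycleSet D z₁ z₂ z₃ z₄ z₅ ∣ ≡ 4)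
  strongCover-guardedBy q q∈T ¬qz₁ q⁺ qz₄ =
    let C , strong , C∩Z≡T = strongVertexCover-avoiding D z₁ T W z₁∉T guard cover
    in  C , strong , trans (cong ∣_∣ C∩Z≡T) ∣T∣≡4
    where
    W : Subset n
    W = ⁅ z₂ ⁆ ∪ ⁅ q ⁆

    guard : ∀ {w} → w ∈ W → w ∈ T × ¬ E D w z₁ × V⁺ D w
    guard w∈W with x∈⁅y⁆∪p⁻ w∈W
    ... | inj₁ refl = z₂∈T , E-asym D z₁z₂ , z₂⁺
    ... | inj₂ w∈⁅q⁆ rewrite x∈⁅y⁆⇒x≡y q w∈⁅q⁆ = q∈T , ¬qz₁ , q⁺

    cover : ∀ {x} → x ∈ T → Adj D z₁ x ⊎ ∃[ w ] (w ∈ W × E D w x)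
    cover x∈T with x∈⁅y⁆∪p⁻ x∈T
    ... | inj₁ refl = inj₁ e12
    ... | inj₂ x∈T₃ with x∈⁅y⁆∪p⁻ x∈T₃
    ...   | inj₁ refl = inj₂ (z₂ , x∈p∪q⁺ (inj₁ (x∈⁅x⁆ z₂)) , z₂z₃)
    ...   | inj₂ x∈T₄ with x∈⁅y⁆∪p⁻ x∈T₄
    ...     | inj₁ refl = inj₂ (q , x∈p∪q⁺ (inj₂ (x∈⁅x⁆ q)) , qz₄)
    ...     | inj₂ x∈⁅z₅⁆ rewrite x∈⁅y⁆⇒x≡y z₅ x∈⁅z₅⁆ = inj₁ (swap e51)

lemma4p3 : ∀ {n} (D : WOG n) (z₁ z₂ z₃ z₄ z₅ : Fin n) →
    Basic5Cycle D z₁ z₂ z₃ z₄ z₅ →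
    E D z₁ z₂ → E D z₂ z₃ → V⁺ D z₂ →
    ((E D z₃ z₄ × V⁺ D z₃) ⊎ (E D z₁ z₅ × E D z₅ z₄ × V⁺ D z₅)) →
    ∃[ C ] (IsStrongVertexCover D C × ∣ C ∩ cycleSet D z₁ z₂ z₃ z₄ z₅ ∣ ≡ 4)
lemma4p3 D z₁ z₂ z₃ z₄ z₅ B z₁z₂ z₂z₃ z₂⁺ (inj₁ (z₃z₄ , z₃⁺)) =
  strongCover-guardedBy z₃ z₃∈T (λ z₃z₁ → n13 (inj₂ z₃z₁)) z₃⁺ z₃z₄
  where open FiveCycle D B z₁z₂ z₂z₃ z₂⁺
        open Basic5Cycle B using (n13)
lemma4p3 D z₁ z₂ z₃ z₄ z₅ B z₁z₂ z₂z₃ z₂⁺ (inj₂ (z₁z₅ , z₅z₄ , z₅⁺)) =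
  strongCover-guardedBy z₅ z₅∈T (E-asym D z₁z₅) z₅⁺ z₅z₄
  where open FiveCycle D B z₁z₂ z₂z₃ z₂⁺
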